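{- Let $A$ be an acyclic polyomino all of whose holes have area one. Suppose $A$ has rectangular interior. Then the cells of the outermost layer of the interior alternate (going around it) between holes and tiles, and there is a color class $W$ of the checkerboard two-coloring of the interior rectangle such that every hole of $A$ is a cell of $W$ (equivalently, every interior cell of the other color class is a tile).
   Context: A polyomino is a finite union of closed unit squares (tiles) of the square lattice, any two of which intersect in nothing, a vertex, or an entire common edge, such that the interior of the union is connected. Holes are the bounded connected components of the complement; the area of a hole is the number of lattice cells it contains. The dual graph has one vertex per tile and an edge between tiles sharing an edge; $A$ is acyclic if its dual graph is a tree. The outer perimeter consists of the unit boundary edges of $A$ not bounding a hole. The boundary layer of $A$ is the set of tiles having at least one edge on the outer perimeter; the interior of $A$ is the set of lattice cells (tiles or hole cells) enclosed by the outer perimeter that are not in the boundary layer. $A$ has rectangular interior if its interior is exactly the set of cells of an $a\times b$ rectangle; the outermost layer of the interior is the set of cells on the border of this rectangle. The checkerboard two-coloring partitions the rectangle's cells into two classes, adjacent cells receiving different classes. -}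

module Defs where

open import Data.Nat using (ℕ; suc; _%_) renaming (_≤_ to _≤ℕ_)
open import Data.Integer using (ℤ; +_; _+_; _≤_; _<_; ∣_∣)
open import Data.Product using (_×_; _,_; Σ; ∃; ∃-syntax; proj₁; proj₂)
open import Data.Sum using (_⊎_)
open import Data.List using (List; []; _∷_; _++_; [_]; zip; length)
open import Data.List.Membership.Propositional using (_∈_)
open import Data.List.Relation.Unary.All using (All)
open import Data.List.Relation.Unary.Unique.Propositional using (Unique)
open import Relation.Binary.PropositionalEquality using (_≡_; _≢_)
open import Relation.Nullary using (¬_)

-- A lattice cell (closed unit square) is named by its lower-left corner.
Cell : Set
Cell = ℤ × ℤ

Adj : Cell → Cell → Set
Adj (x , y) (x' , y') =
  (x ≡ x' × (y' ≡ y + + 1 ⊎ y ≡ y' + + 1)) ⊎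
  (y ≡ y' × (x' ≡ x + + 1 ⊎ x ≡ x' + + 1))

-- A finite set of tiles, given as a duplicate-free list of cells.
Tile : List Cell → Cell → Set
Tile ts c = c ∈ ts

data TReach (ts : List Cell) : Cell → Cell → Set where
  here : ∀ {c} → Tile ts c → TReach ts c c
  step : ∀ {c d e} → TReach ts c d → Adj d e → Tile ts e → TReach ts c e

cyclicPairs : List Cell → List (Cell × Cell)
cyclicPairs []       = []
cyclicPairs (v ∷ vs) = zip (v ∷ vs) (vs ++ [ v ])

DualCycle : List Cell → List Cell → Set
DualCycle ts vs =
  3 ≤ℕ length vs × Unique vs × All (Tile ts) vs ×
  All (λ p → Adj (proj₁ p) (proj₂ p)) (cyclicPairs vs)

DualConnected : List Cell → Set
DualConnected ts = ∀ c d → Tile ts c → Tile ts d → TReach ts c d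

-- A polyomino: nonempty finite duplicate-free set of tiles with connected
-- interior (for lattice squares: the dual graph is connected).
Polyomino : List Cell → Set
Polyomino ts = ts ≢ [] × Unique ts × DualConnected ts

Acyclic : List Cell → Set
Acyclic ts = DualConnected ts × (∀ vs → ¬ DualCycle ts vs)

data Reach (ts : List Cell) : Cell → Cell → Set where
  here : ∀ {c} → ¬ Tile ts c → Reach ts c c
  step : ∀ {c d e} → Reach ts c d → Adj d e → ¬ Tile ts e → Reach ts c e

BoundedComp : List Cell → Cell → Set
BoundedComp ts c = ∃[ N ] (∀ d → Reach ts c d → ∣ proj₁ d ∣ ≤ℕ N × ∣ proj₂ d ∣ ≤ℕ N)

HoleCell : List Cell → Cell → Set
HoleCell ts c = ¬ Tile ts c × BoundedComp ts c

Exterior : List Cell → Cell → Set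
Exterior ts c = ¬ Tile ts c × ¬ BoundedComp ts c

HolesAreaOne : List Cell → Set
HolesAreaOne ts = ∀ h → HoleCell ts h → ∀ d → Reach ts h d → d ≡ h

-- Boundary layer: tiles having an edge on the outer perimeter,
-- i.e. sharing an edge with an exterior cell.
BoundaryTile : List Cell → Cell → Set
BoundaryTile ts t = Tile ts t × ∃[ c ] (Adj t c × Exterior ts c)

-- Interior: cells enclosed by the outer perimeter (tiles or hole cells)
-- that are not in the boundary layer.
Interior : List Cell → Cell → Set
Interior ts c = (Tile ts c ⊎ HoleCell ts c) × ¬ BoundaryTile ts c

InRect : ℤ → ℤ → ℕ → ℕ → Cell → Set
InRect x0 y0 a b (x , y) = (x0 ≤ x × x < x0 + + a) × (y0 ≤ y × y < y0 + + b)

OnBorder : ℤ → ℤ → ℕ → ℕ → Cell → Set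
OnBorder x0 y0 a b (x , y) = InRect x0 y0 a b (x , y) ×
  (x ≡ x0 ⊎ x + + 1 ≡ x0 + + a ⊎ y ≡ y0 ⊎ y + + 1 ≡ y0 + + b)

colour : Cell → ℕ
colour (x , y) = ∣ x + y ∣ % 2

module Submission where

open import Defs
open import Data.Nat using (ℕ; _<_; _≤_)
open import Data.Integer using (ℤ)
open import Data.Product using (_×_; _,_; ∃; ∃-syntax)
open import Data.Sum using (_⊎_)
open import Data.List using (List)
open import Function.Bundles using (_⇔_)
open import Relation.Binary.PropositionalEquality using (_≡_)

open import Algebra.Bundles using (AbelianGroup)
open import Data.Bool using (Bool; true; false)
import Data.Bool as Bool
open import Data.Empty using (⊥; ⊥-elim)
open import Data.Fin using (toℕ)
import Data.Fin.Properties as FinP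
open import Data.Integer as ℤ using (+_; -[1+_]; _+_; -_; 0ℤ; 1ℤ; -1ℤ)
import Data.Integer.Properties as ℤP
open import Data.Integer.Tactic.RingSolver using (solve-∀)
open import Data.List using ([]; _∷_; _∷ʳ_; zip; applyUpTo; length; lookup)
import Data.List.Membership.DecPropositional as DecMembership
open import Data.List.Properties using (length-applyUpTo; applyUpTo-∷ʳ)
open import Data.List.Relation.Unary.All using (All; []; _∷_)
import Data.List.Relation.Unary.All.Properties as AllP
open import Data.List.Relation.Unary.AllPairs using ([]; _∷_)
open import Data.List.Relation.Unary.Any using (index)
open import Data.List.Relation.Unary.Any.Properties using (lookup-index)
open import Data.List.Relation.Unary.Unique.Propositional using (Unique)
import Data.List.Relation.Unary.Unique.Propositional.Properties as UniqueP
import Data.Nat as ℕ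
open import Data.Nat.DivMod using (m%n<n)
open import Data.Nat.Induction using (<-rec)
import Data.Nat.Properties as ℕP
open import Data.Product using (∃₂; proj₁; proj₂)
open import Data.Product.Properties using (≡-dec)
open import Data.Sum using (inj₁; inj₂)
open import Function.Bundles using (Equivalence)
open import Relation.Binary.Definitions using (DecidableEquality)
open import Relation.Binary.PropositionalEquality
  using (_≢_; refl; sym; trans; cong; cong₂; subst; subst₂; module ≡-Reasoning)
open import Relation.Nullary using (¬_; Dec; yes; no; does; ¬?; _×-dec_; _⊎-dec_)
open import Relation.Nullary.Decidable using (decidable-stable; dec-true; dec-false; map′)
open import Relation.Unary using (Decidable)
open import Algebra.Properties.Group (AbelianGroup.group ℤP.+-0-abelianGroup) using (∙-cancelˡ)

-- Two local facts drive the proof: a neighbour of a hole is a tile (holes have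
-- area one), and a cell outside R next to R is a tile (it is in the boundary
-- layer).  As the dual graph has no cycle, there is no 2 × 2 block of tiles.
-- (1) Neighbouring border cells of R are not both holes, by the first fact, and
--     not both tiles: with the tiles just outside R they would close a 2 × 2
--     block (when R is two cells thick, a block closes on one side or the other).
-- (2) Colours alternate along the border as well, so its holes share a colour p.
--     Call an interior hole of the other colour misplaced; misplaced holes lie
--     strictly inside R, and a diagonal neighbour of one is a tile or misplaced.
--     Mark the 2 × 2 windows of cells containing a misplaced cell.  A side of a
--     cell whose end windows differ in marking is flanked by tiles, and such a
--     cell has a second such side; walking through these sides never turns
--     back, so by pigeonhole it closes a cycle of tiles.  So no hole is misplaced.

infixl 6 _⊕_
_⊕_ : Cell → Cell → Cell
(x , y) ⊕ (i , j) = (x + i , y + j)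

𝟎 : Cell
𝟎 = (0ℤ , 0ℤ)

⊕-assoc : ∀ c u v → c ⊕ u ⊕ v ≡ c ⊕ (u ⊕ v)
⊕-assoc (x , y) (i , j) (k , l) = cong₂ _,_ (ℤP.+-assoc x i k) (ℤP.+-assoc y j l)

⊕-identityʳ : ∀ c → c ⊕ 𝟎 ≡ c
⊕-identityʳ (x , y) = cong₂ _,_ (ℤP.+-identityʳ x) (ℤP.+-identityʳ y)

⊕-cancelˡ : ∀ c {u v} → c ⊕ u ≡ c ⊕ v → u ≡ v
⊕-cancelˡ (x , y) {i , j} {k , l} e =
  cong₂ _,_ (∙-cancelˡ x i k (cong proj₁ e)) (∙-cancelˡ y j l (cong proj₂ e))

pred-suc : ∀ z → z ≡ z + -1ℤ + 1ℤ
pred-suc = solve-∀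

suc-pred : ∀ z → z ≡ z + 1ℤ + -1ℤ
suc-pred = solve-∀

-- The corners of a cell in counter-clockwise order.  Side κ of a cell runs
-- from corner κ to corner next κ, and crossing it moves by across κ.
data Corner : Set where
  bl br tr tl : Corner

next : Corner → Corner
next bl = br
next br = tr
next tr = tl
next tl = bl

opposite : Corner → Corner
opposite κ = next (next κ)

next⁴ : ∀ κ → next (next (next (next κ))) ≡ κ
next⁴ bl = refl
next⁴ br = refl
next⁴ tr = refl
next⁴ tl = refl

next≢ : ∀ κ → next κ ≢ κ
next≢ bl ()
next≢ br ()
next≢ tr ()
next≢ tl ()

next²≢ : ∀ κ → next (next κ) ≢ κ
next²≢ bl ()
next²≢ br ()
next²≢ tr ()
next²≢ tl ()

next³≢ : ∀ κ → next (next (next κ)) ≢ κ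
next³≢ bl ()
next³≢ br ()
next³≢ tr ()
next³≢ tl ()

across : Corner → Cell
across bl = (0ℤ , -1ℤ)
across br = (1ℤ , 0ℤ)
across tr = (0ℤ , 1ℤ)
across tl = (-1ℤ , 0ℤ)

across-opposite : ∀ κ → across κ ⊕ across (opposite κ) ≡ 𝟎
across-opposite bl = refl
across-opposite br = refl
across-opposite tr = refl
across-opposite tl = refl

across-injective : ∀ {κ κ′} → across κ ≡ across κ′ → κ ≡ κ′
across-injective {bl} {bl} _ = refl
across-injective {br} {br} _ = refl
across-injective {tr} {tr} _ = refl
across-injective {tl} {tl} _ = refl
across-injective {bl} {br} ()
across-injective {bl} {tr} ()
across-injective {bl} {tl} ()
across-injective {br} {bl} ()
across-injective {br} {tr} ()
across-injective {br} {tl} ()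
across-injective {tr} {bl} ()
across-injective {tr} {br} ()
across-injective {tr} {tl} ()
across-injective {tl} {bl} ()
across-injective {tl} {br} ()
across-injective {tl} {tr} ()

_≟ᶜ_ : DecidableEquality Cell
_≟ᶜ_ = ≡-dec ℤP._≟_ ℤP._≟_

adj-up : ∀ x y → Adj (x , y) (x , y + 1ℤ)
adj-up x y = inj₁ (refl , inj₁ refl)

adj-right : ∀ x y → Adj (x , y) (x + 1ℤ , y)
adj-right x y = inj₂ (refl , inj₁ refl)

adj-across : ∀ c κ → Adj c (c ⊕ across κ)
adj-across (x , y) bl = inj₁ (sym (ℤP.+-identityʳ x) , inj₂ (pred-suc y))
adj-across (x , y) br = inj₂ (sym (ℤP.+-identityʳ y) , inj₁ refl)
adj-across (x , y) tr = inj₁ (sym (ℤP.+-identityʳ x) , inj₁ refl)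
adj-across (x , y) tl = inj₂ (sym (ℤP.+-identityʳ y) , inj₂ (pred-suc x))

adj-sym : ∀ {c d} → Adj c d → Adj d c
adj-sym (inj₁ (e , inj₁ f)) = inj₁ (sym e , inj₂ f)
adj-sym (inj₁ (e , inj₂ f)) = inj₁ (sym e , inj₁ f)
adj-sym (inj₂ (e , inj₁ f)) = inj₂ (sym e , inj₂ f)
adj-sym (inj₂ (e , inj₂ f)) = inj₂ (sym e , inj₁ f)

z≢z+1 : ∀ z → z ≢ z + 1ℤ
z≢z+1 z e = ℤP.i≢suc[i] (trans e (ℤP.+-comm z 1ℤ))

adj-irrefl : ∀ {c} → ¬ Adj c c
adj-irrefl (inj₁ (_ , inj₁ e)) = z≢z+1 _ e
adj-irrefl (inj₁ (_ , inj₂ e)) = z≢z+1 _ e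
adj-irrefl (inj₂ (_ , inj₁ e)) = z≢z+1 _ e
adj-irrefl (inj₂ (_ , inj₂ e)) = z≢z+1 _ e

parity : ℤ → ℕ
parity z = ℤ.∣ z ∣ ℕ.% 2

flip : ℕ → ℕ
flip n = 1 ℕ.∸ n

flip-involutive : ∀ {n} → n < 2 → flip (flip n) ≡ n
flip-involutive {0} _ = refl
flip-involutive {1} _ = refl
flip-involutive {ℕ.suc (ℕ.suc _)} (ℕ.s≤s (ℕ.s≤s ()))

flip<2 : ∀ n → flip n < 2
flip<2 n = ℕ.s≤s (ℕP.m∸n≤m 1 n)

colour<2 : ∀ c → colour c < 2
colour<2 (x , y) = m%n<n ℤ.∣ x + y ∣ 2

suc-parity : ∀ n → ℕ.suc n ℕ.% 2 ≡ flip (n ℕ.% 2)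
suc-parity 0 = refl
suc-parity 1 = refl
suc-parity (ℕ.suc (ℕ.suc n)) = suc-parity n

parity-suc : ∀ z → parity (z + 1ℤ) ≡ flip (parity z)
parity-suc (+ n)          = trans (cong (ℕ._% 2) (ℕP.+-comm n 1)) (suc-parity n)
parity-suc -[1+ 0 ]       = refl
parity-suc -[1+ ℕ.suc n ] =
  sym (trans (cong flip (suc-parity (ℕ.suc n))) (flip-involutive (m%n<n (ℕ.suc n) 2)))

colour-succ : ∀ c d → proj₁ d + proj₂ d ≡ proj₁ c + proj₂ c + 1ℤ → colour d ≡ flip (colour c)
colour-succ (x , y) _ e = trans (cong parity e) (parity-suc (x + y))

colour-swap : ∀ c d → colour c ≡ flip (colour d) → colour d ≡ flip (colour c)
colour-swap c d e = sym (trans (cong flip e) (flip-involutive (colour<2 d)))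

up-sum : ∀ x y → x + (y + 1ℤ) ≡ x + y + 1ℤ
up-sum x y = sym (ℤP.+-assoc x y 1ℤ)

right-sum : ∀ x y → x + 1ℤ + y ≡ x + y + 1ℤ
right-sum = solve-∀

colour-adj : ∀ {c d} → Adj c d → colour d ≡ flip (colour c)
colour-adj {x , y}     (inj₁ (refl , inj₁ refl)) = colour-succ (x , y) (x , y + 1ℤ) (up-sum x y)
colour-adj {c} {x , y} (inj₁ (refl , inj₂ refl)) = colour-swap c (x , y) (colour-succ (x , y) c (up-sum x y))
colour-adj {x , y}     (inj₂ (refl , inj₁ refl)) = colour-succ (x , y) (x + 1ℤ , y) (right-sum x y)
colour-adj {c} {x , y} (inj₂ (refl , inj₂ refl)) = colour-swap c (x , y) (colour-succ (x , y) c (right-sum x y))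

colour-diagonal : ∀ c κ → colour (c ⊕ (across κ ⊕ across (next κ))) ≡ colour c
colour-diagonal c κ = begin
  colour (c ⊕ (across κ ⊕ across (next κ)))  ≡⟨ cong colour (sym (⊕-assoc c _ _)) ⟩
  colour (c ⊕ across κ ⊕ across (next κ))    ≡⟨ colour-adj (adj-across (c ⊕ across κ) (next κ)) ⟩
  flip (colour (c ⊕ across κ))               ≡⟨ cong flip (colour-adj (adj-across c κ)) ⟩
  flip (flip (colour c))                     ≡⟨ flip-involutive (colour<2 c) ⟩
  colour c                                   ∎
  where open ≡-Reasoning

Within : ℤ → ℕ → ℤ → Set
Within lo n z = lo ℤ.≤ z × z ℤ.< lo + + n

EndOf : ℤ → ℕ → ℤ → Set
EndOf lo n z = z ≡ lo ⊎ z + 1ℤ ≡ lo + + n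

Inner : ℤ → ℕ → ℤ → Set
Inner lo n z = lo ℤ.< z × z + 1ℤ ℤ.< lo + + n

last : ℤ → ℕ → ℤ
last lo n = lo + + n + -1ℤ

z<z+1 : ∀ z → z ℤ.< z + 1ℤ
z<z+1 z = ℤP.suc[i]≤j⇒i<j (ℤP.≤-reflexive (ℤP.+-comm 1ℤ z))

z-1<z : ∀ z → z + -1ℤ ℤ.< z
z-1<z z = subst (ℤ._< z) (ℤP.+-comm -1ℤ z) (ℤP.i≤pred[j]⇒i<j ℤP.≤-refl)

<⇒+1≤ : ∀ {i j} → i ℤ.< j → i + 1ℤ ℤ.≤ j
<⇒+1≤ {i} i<j = subst (ℤ._≤ _) (ℤP.+-comm 1ℤ i) (ℤP.i<j⇒suc[i]≤j i<j)

within-index : ∀ {lo n z} → Within lo n z → ∃ λ k → k < n × z ≡ lo + + k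
within-index {lo} {n} {z} (lo≤z , z<end) =
  ℤ.∣ z ℤ.- lo ∣ , ℤP.drop‿+<+ k<n , trans (shift lo z) (cong (λ m → lo + m) (sym k≡z-lo))
  where
  shift : ∀ lo z → z ≡ lo + (z ℤ.- lo)
  shift = solve-∀
  cancel : ∀ lo n → lo + n ℤ.- lo ≡ n
  cancel = solve-∀
  k≡z-lo : + ℤ.∣ z ℤ.- lo ∣ ≡ z ℤ.- lo
  k≡z-lo = ℤP.0≤i⇒+∣i∣≡i (ℤP.i≤j⇒0≤j-i lo≤z)
  k<n : + ℤ.∣ z ℤ.- lo ∣ ℤ.< + n
  k<n = subst₂ ℤ._<_ (sym k≡z-lo) (cancel lo (+ n)) (ℤP.+-monoˡ-< (- lo) z<end)

index-within : ∀ lo {n k} → k < n → Within lo n (lo + + k)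
index-within lo k<n = ℤP.i≤i+j lo (+ _) , ℤP.+-monoʳ-< lo (ℤ.+<+ k<n)

suc-index : ∀ lo k → lo + + k + 1ℤ ≡ lo + + ℕ.suc k
suc-index lo k = trans (ℤP.+-assoc lo (+ k) 1ℤ) (cong (λ m → lo + + m) (ℕP.+-comm k 1))

interval-ind : ∀ lo n (P : ℤ → Set) → P lo →
  (∀ z → Within lo n z → Within lo n (z + 1ℤ) → P z → P (z + 1ℤ)) →
  ∀ z → Within lo n z → P z
interval-ind lo n P base climb z w with within-index w
... | m , m<n , refl = go m m<n
  where
  go : ∀ k → k < n → P (lo + + k)
  go ℕ.zero _ = subst P (sym (ℤP.+-identityʳ lo)) base
  go (ℕ.suc k) k+1<n = subst P (suc-index lo k)
    (climb (lo + + k) (index-within lo k<n)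
          (subst (Within lo n) (sym (suc-index lo k)) (index-within lo k+1<n)) (go k k<n))
    where
    k<n : k < n
    k<n = ℕP.<-trans (ℕP.n<1+n k) k+1<n

lo-within : ∀ lo {n} → 1 ≤ n → Within lo n lo
lo-within lo 0<n = subst (Within _ _) (ℤP.+-identityʳ lo) (index-within lo 0<n)

last-end : ∀ lo n → last lo n + 1ℤ ≡ lo + + n
last-end lo n = sym (pred-suc (lo + + n))

end-last : ∀ {z} lo n → z + 1ℤ ≡ lo + + n → z ≡ last lo n
end-last {z} _ _ e = trans (suc-pred z) (cong (_+ -1ℤ) e)

last-within : ∀ lo {n} → 1 ≤ n → Within lo n (last lo n)
last-within lo {ℕ.suc n} _ =
  subst (Within lo (ℕ.suc n)) (end-last lo (ℕ.suc n) (suc-index lo n)) (index-within lo (ℕP.n<1+n n))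

below-outside : ∀ lo n → ¬ Within lo n (lo + -1ℤ)
below-outside lo n (lo≤ , _) = ℤP.<⇒≱ (z-1<z lo) lo≤

above-outside : ∀ {lo n} z → z + 1ℤ ≡ lo + + n → ¬ Within lo n (z + 1ℤ)
above-outside _ e (_ , <end) = ℤP.<-irrefl e <end

next-within : ∀ {lo n z} → Within lo n z → z + 1ℤ ≢ lo + + n → Within lo n (z + 1ℤ)
next-within (lo≤z , z<end) ne = ℤP.≤-trans lo≤z (ℤP.<⇒≤ (z<z+1 _)) , ℤP.≤∧≢⇒< (<⇒+1≤ z<end) ne

lower-end : ∀ {lo n z} → EndOf lo n z → Within lo n (z + 1ℤ) → z ≡ lo
lower-end (inj₁ e) _ = e
lower-end (inj₂ e) (_ , <end) = ⊥-elim (ℤP.<-irrefl e <end)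

upper-end : ∀ {lo n z} → EndOf lo n (z + 1ℤ) → Within lo n z → z + 1ℤ + 1ℤ ≡ lo + + n
upper-end {z = z} (inj₁ e) (lo≤z , _) = ⊥-elim (ℤP.<⇒≱ (subst (z ℤ.<_) e (z<z+1 z)) lo≤z)
upper-end (inj₂ e) _ = e

inner : ∀ {lo n z} → Within lo n z → ¬ EndOf lo n z → Inner lo n z
inner (lo≤z , z<end) not-end =
  ℤP.≤∧≢⇒< lo≤z (λ e → not-end (inj₁ (sym e))) , ℤP.≤∧≢⇒< (<⇒+1≤ z<end) (λ e → not-end (inj₂ e))

data Small : ℤ → Set where
  s⁻ : Small -1ℤ
  s⁰ : Small 0ℤ
  s⁺ : Small 1ℤ

inner-shift : ∀ {lo n z i} → Inner lo n z → Small i → Within lo n (z + i)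
inner-shift {z = z} (lo<z , z+1<end) s⁻ =
  subst (_ ℤ.≤_) (ℤP.+-comm -1ℤ z) (ℤP.i<j⇒i≤pred[j] lo<z) ,
  ℤP.<-trans (z-1<z z) (ℤP.<-trans (z<z+1 z) z+1<end)
inner-shift {z = z} (lo<z , z+1<end) s⁰ =
  subst (Within _ _) (sym (ℤP.+-identityʳ z)) (ℤP.<⇒≤ lo<z , ℤP.<-trans (z<z+1 z) z+1<end)
inner-shift {z = z} (lo<z , z+1<end) s⁺ = ℤP.<⇒≤ (ℤP.<-trans lo<z (z<z+1 z)) , z+1<end

-- The 2 × 2 window at corner κ of a cell t has lower-left cell t ⊕ window-at κ.
window-at : Corner → Cell
window-at bl = (-1ℤ , -1ℤ)
window-at br = (0ℤ , -1ℤ)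
window-at tr = (0ℤ , 0ℤ)
window-at tl = (-1ℤ , 0ℤ)

across-windows : ∀ κ → across κ ⊕ window-at (opposite κ) ≡ window-at (next κ) ×
                       across κ ⊕ window-at (next (opposite κ)) ≡ window-at κ
across-windows bl = refl , refl
across-windows br = refl , refl
across-windows tr = refl , refl
across-windows tl = refl , refl

data Bit : ℤ → Set where
  bit0 : Bit 0ℤ
  bit1 : Bit 1ℤ

data InWindow (w : Cell) : Cell → Set where
  cell-at : ∀ {i j} → Bit i → Bit j → InWindow w (w ⊕ (i , j))

in-window : ∀ t o {i j} → Bit i → Bit j → InWindow (t ⊕ o) (t ⊕ (o ⊕ (i , j)))
in-window t o bi bj = subst (InWindow (t ⊕ o)) (⊕-assoc t o _) (cell-at bi bj)

Shared : Cell → Corner → Cell → Set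
Shared t κ c = InWindow (t ⊕ window-at κ) c × InWindow (t ⊕ window-at (next κ)) c

side-shared : ∀ t κ → Shared t κ (t ⊕ 𝟎) × Shared t κ (t ⊕ across κ)
side-shared t bl = (in-window t _ bit1 bit1 , in-window t _ bit0 bit1) ,
                   (in-window t _ bit1 bit0 , in-window t _ bit0 bit0)
side-shared t br = (in-window t _ bit0 bit1 , in-window t _ bit0 bit0) ,
                   (in-window t _ bit1 bit1 , in-window t _ bit1 bit0)
side-shared t tr = (in-window t _ bit0 bit0 , in-window t _ bit1 bit0) ,
                   (in-window t _ bit0 bit1 , in-window t _ bit1 bit1)
side-shared t tl = (in-window t _ bit1 bit0 , in-window t _ bit1 bit1) ,
                   (in-window t _ bit0 bit0 , in-window t _ bit0 bit1)

bit-diff : ∀ {i k} → Bit i → Bit k → Small (k ℤ.- i)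
bit-diff bit0 bit0 = s⁰
bit-diff bit0 bit1 = s⁺
bit-diff bit1 bit0 = s⁻
bit-diff bit1 bit1 = s⁰

window-near : ∀ {w b c} → InWindow w b → InWindow w c →
  ∃₂ λ i j → Small i × Small j × c ≡ b ⊕ (i , j)
window-near {x , y} (cell-at {i} {j} bi bj) (cell-at {k} {l} bk bm) =
  k ℤ.- i , l ℤ.- j , bit-diff bi bk , bit-diff bj bm , cong₂ _,_ (regroup x i k) (regroup y j l)
  where
  regroup : ∀ x i k → x + k ≡ x + i + (k ℤ.- i)
  regroup = solve-∀

zip-steps : (g : ℕ → Cell) → (∀ k → Adj (g k) (g (ℕ.suc k))) →
  ∀ L → All (λ p → Adj (proj₁ p) (proj₂ p)) (zip (applyUpTo g L) (applyUpTo (λ k → g (ℕ.suc k)) L))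
zip-steps g adj ℕ.zero    = []
zip-steps g adj (ℕ.suc L) = adj 0 ∷ zip-steps (λ k → g (ℕ.suc k)) (λ k → adj (ℕ.suc k)) L

-- A walk through the tiles of a finite polyomino that never immediately
-- turns back must revisit a tile; between the first revisit and the earlier
-- visit it traces a cycle of the dual graph.
module NonBacktrackingWalk {ts : List Cell} (f : ℕ → Cell)
  (f-tile : ∀ k → Tile ts (f k))
  (f-adj : ∀ k → Adj (f k) (f (ℕ.suc k)))
  (f-turn : ∀ k → f (ℕ.suc (ℕ.suc k)) ≢ f k) where

  segment : ℕ → ℕ → List Cell
  segment i L = applyUpTo (λ k → f (k ℕ.+ i)) L

  segment-cycle : ∀ i L → 3 ≤ L → f (L ℕ.+ i) ≡ f i →
    (∀ {k l} → k < l → l < L → f (k ℕ.+ i) ≢ f (l ℕ.+ i)) → DualCycle ts (segment i L)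
  segment-cycle i L@(ℕ.suc L′) long closes distinct =
    subst (3 ≤_) (sym (length-applyUpTo g L)) long ,
    UniqueP.applyUpTo⁺₁ g L distinct ,
    AllP.applyUpTo⁺₂ g L (λ k → f-tile (k ℕ.+ i)) ,
    subst (λ ys → All (λ p → Adj (proj₁ p) (proj₂ p)) (zip (segment i L) ys)) wraps
      (zip-steps g (λ k → f-adj (k ℕ.+ i)) L)
    where
    g : ℕ → Cell
    g k = f (k ℕ.+ i)
    -- the successors of the segment are the segment rotated by one
    wraps : applyUpTo (λ k → g (ℕ.suc k)) L ≡ applyUpTo (λ k → g (ℕ.suc k)) L′ ∷ʳ f i
    wraps = trans (sym (applyUpTo-∷ʳ (λ k → g (ℕ.suc k)) L′))
                  (cong (applyUpTo (λ k → g (ℕ.suc k)) L′ ∷ʳ_) closes)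

  Revisit : ℕ → Set
  Revisit j = ∃ λ i → i < j × f i ≡ f j

  revisit? : ∀ j → Dec (Revisit j)
  revisit? j = ℕP.anyUpTo? (λ i → f i ≟ᶜ f j) j

  -- Pigeonhole: among the first |ts| + 1 positions some tile is revisited.
  some-revisit : ∃ Revisit
  some-revisit with FinP.pigeonhole (ℕP.n<1+n (length ts)) (λ k → index (f-tile (toℕ k)))
  ... | i , j , i<j , same =
    toℕ j , toℕ i , i<j ,
    trans (lookup-index (f-tile (toℕ i))) (trans (cong (lookup ts) same) (sym (lookup-index (f-tile (toℕ j)))))

  FirstRevisit : Set
  FirstRevisit = ∃ λ j → Revisit j × (∀ {l} → l < j → ¬ Revisit l)

  first-revisit : ∀ j → Revisit j → FirstRevisit
  first-revisit = <-rec _ λ j earlier r → search j earlier r (ℕP.anyUpTo? revisit? j)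
    where
    search : ∀ j → (∀ {l} → l < j → Revisit l → FirstRevisit) → Revisit j →
             Dec (∃ λ l → l < j × Revisit l) → FirstRevisit
    search j earlier r (yes (l , l<j , rl)) = earlier l<j rl
    search j earlier r (no none)            = j , r , λ l<j rl → none (_ , l<j , rl)

  walk-cycle : ∃ (DualCycle ts)
  walk-cycle with first-revisit _ (proj₂ some-revisit)
  ... | j , (i , i<j , same) , first = segment i L , segment-cycle i L (long L refl closes) closes distinct
    where
    L : ℕ
    L = j ℕ.∸ i
    closes : f (L ℕ.+ i) ≡ f i
    closes = trans (cong f (ℕP.m∸n+n≡m (ℕP.<⇒≤ i<j))) (sym same)
    -- a return after one step contradicts adjacency, after two steps the no-turning rule
    long : ∀ n → n ≡ L → f (n ℕ.+ i) ≡ f i → 3 ≤ n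
    long ℕ.zero e _ = ⊥-elim (ℕP.<⇒≢ (ℕP.m<n⇒0<n∸m i<j) e)
    long (ℕ.suc ℕ.zero) _ c = ⊥-elim (adj-irrefl (subst (Adj (f i)) c (f-adj i)))
    long (ℕ.suc (ℕ.suc ℕ.zero)) _ c = ⊥-elim (f-turn i c)
    long (ℕ.suc (ℕ.suc (ℕ.suc _))) _ _ = ℕ.s≤s (ℕ.s≤s (ℕ.s≤s ℕ.z≤n))
    distinct : ∀ {k l} → k < l → l < L → f (k ℕ.+ i) ≢ f (l ℕ.+ i)
    distinct {k} {l} k<l l<L e =
      first (subst (l ℕ.+ i <_) (ℕP.m∸n+n≡m (ℕP.<⇒≤ i<j)) (ℕP.+-monoˡ-< i l<L))
            (k ℕ.+ i , ℕP.+-monoˡ-< i k<l , e)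

another-change : ∀ {A : Set} → DecidableEquality A → (a b c d : A) → a ≢ b → b ≢ c ⊎ c ≢ d ⊎ d ≢ a
another-change _≟_ a b c d a≢b with b ≟ c | c ≟ d
... | no b≢c   | _        = inj₁ b≢c
... | yes _    | no c≢d   = inj₂ (inj₁ c≢d)
... | yes refl | yes refl = inj₂ (inj₂ (λ d≡a → a≢b (sym d≡a)))

first-drop : (g : ℕ → Bool) → ∀ K → g 0 ≡ true → g K ≡ false → ∃ λ k → g k ≡ true × g (ℕ.suc k) ≡ false
first-drop g ℕ.zero    g0 gK with () ← trans (sym g0) gK
first-drop g (ℕ.suc K) g0 gK with g K in gK′
... | true  = K , gK′ , gK
... | false = first-drop g K g0 gK′

decisions-differ : ∀ {A B : Set} (a? : Dec A) (b? : Dec B) → does a? ≢ does b? → (A × ¬ B) ⊎ (¬ A × B)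
decisions-differ (yes a)  (no ¬b) _  = inj₁ (a , ¬b)
decisions-differ (no ¬a)  (yes b) _  = inj₂ (¬a , b)
decisions-differ (yes _)  (yes _) ne = ⊥-elim (ne refl)
decisions-differ (no _)   (no _)  ne = ⊥-elim (ne refl)

bit≤1 : ∀ {i} → Bit i → i ℤ.≤ 1ℤ
bit≤1 bit0 = ℤ.+≤+ ℕ.z≤n
bit≤1 bit1 = ℤP.≤-refl

-- Statements
-- about a domino along the v-axis then cover both orientations.
data Frame : Set where
  upright transposed : Frame

at : Frame → ℤ → ℤ → Cell
at upright    u v = (u , v)
at transposed u v = (v , u)

adj-u : ∀ o {u u′ v} → u′ ≡ u + 1ℤ → Adj (at o u v) (at o u′ v)
adj-u upright    {u} {v = v} refl = adj-right u v
adj-u transposed {u} {v = v} refl = adj-up v u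

adj-v : ∀ o {u v v′} → v′ ≡ v + 1ℤ → Adj (at o u v) (at o u v′)
adj-v upright    {u} {v} refl = adj-up u v
adj-v transposed {u} {v} refl = adj-right v u

-- The hypotheses of the theorem.
module Setting (ts : List Cell) (no-cycle : ∀ vs → ¬ DualCycle ts vs) (holes-small : HolesAreaOne ts)
  (x0 y0 : ℤ) (a b : ℕ) (a≥1 : 1 ≤ a) (b≥1 : 1 ≤ b)
  (interior : ∀ c → Interior ts c ⇔ InRect x0 y0 a b c) where

  T : Cell → Set
  T = Tile ts

  Hole : Cell → Set
  Hole = HoleCell ts

  R : Cell → Set
  R = InRect x0 y0 a b

  OnB : Cell → Set
  OnB = OnBorder x0 y0 a b

  tile? : Decidable T
  tile? c = DecMembership._∈?_ _≟ᶜ_ c ts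

  tile-by : ∀ {c} → ¬ ¬ T c → T c
  tile-by {c} = decidable-stable (tile? c)

  -- Every neighbour of a hole is a tile, since holes have area one.
  hole-nbr-tile : ∀ {h d} → Hole h → Adj h d → T d
  hole-nbr-tile {h} {d} H adj = tile-by λ nt →
    adj-irrefl (subst (Adj h) (holes-small h H d (step (here (proj₁ H)) adj nt)) adj)

  tile-or-hole : ∀ {c} → R c → T c ⊎ Hole c
  tile-or-hole {c} r = proj₁ (Equivalence.from (interior c) r)

  hole-inside : ∀ {c} → Hole c → R c
  hole-inside {c} H = Equivalence.to (interior c) (inj₂ H , λ boundary → proj₁ H (proj₁ boundary))

  nontile-hole : ∀ {c} → R c → ¬ T c → Hole c
  nontile-hole r nt with tile-or-hole r
  ... | inj₁ t = ⊥-elim (nt t)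
  ... | inj₂ H = H

  -- A neighbour of the interior outside it is a tile: a non-tile there would
  -- be exterior (holes are interior), and no interior tile touches the exterior.
  rim-tile : ∀ {c d} → R c → Adj c d → ¬ R d → T d
  rim-tile {c} {d} r adj out = tile-by λ nt → inner-side nt (tile-or-hole r)
    where
    inner-side : ¬ T d → T c ⊎ Hole c → ⊥
    inner-side nt (inj₂ H) = nt (hole-nbr-tile H adj)
    inner-side nt (inj₁ t) = proj₂ (Equivalence.from (interior c) r)
      (t , d , adj , nt , λ bounded → out (hole-inside (nt , bounded)))

  -- A 2 × 2 block of tiles would be a 4-cycle of the dual graph.
  no-block : ∀ {x x′ y y′} → x′ ≡ x + 1ℤ → y′ ≡ y + 1ℤ →
    T (x , y) → T (x′ , y) → T (x , y′) → T (x′ , y′) → ⊥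
  no-block {x} {_} {y} refl refl t₀₀ t₁₀ t₀₁ t₁₁ =
    no-cycle square (ℕ.s≤s (ℕ.s≤s (ℕ.s≤s ℕ.z≤n)) , distinct , t₀₀ ∷ t₁₀ ∷ t₁₁ ∷ t₀₁ ∷ [] , around)
    where
    square : List Cell
    square = (x , y) ∷ (x + 1ℤ , y) ∷ (x + 1ℤ , y + 1ℤ) ∷ (x , y + 1ℤ) ∷ []
    x≢ : ∀ {v w} → (x , v) ≢ (x + 1ℤ , w)
    x≢ e = z≢z+1 x (cong proj₁ e)
    x≢′ : ∀ {v w} → (x + 1ℤ , v) ≢ (x , w)
    x≢′ e = x≢ (sym e)
    y≢ : ∀ {u w} → (u , y) ≢ (w , y + 1ℤ)
    y≢ e = z≢z+1 y (cong proj₂ e)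
    distinct : Unique square
    distinct = (x≢ ∷ x≢ ∷ y≢ ∷ []) ∷ (y≢ ∷ x≢′ ∷ []) ∷ (x≢′ ∷ []) ∷ [] ∷ []
    around : All (λ p → Adj (proj₁ p) (proj₂ p)) (cyclicPairs square)
    around = adj-right x y ∷ adj-up (x + 1ℤ) y ∷ adj-sym (adj-right x (y + 1ℤ)) ∷ adj-sym (adj-up x y) ∷ []

  lo₁ lo₂ : Frame → ℤ
  lo₁ upright = x0
  lo₁ transposed = y0
  lo₂ upright = y0
  lo₂ transposed = x0

  n₁ n₂ : Frame → ℕ
  n₁ upright = a
  n₁ transposed = b
  n₂ upright = b
  n₂ transposed = a

  In₁ In₂ : Frame → ℤ → Set
  In₁ o = Within (lo₁ o) (n₁ o)
  In₂ o = Within (lo₂ o) (n₂ o)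

  frame-in : ∀ o {u v} → In₁ o u → In₂ o v → R (at o u v)
  frame-in upright    iu iv = iu , iv
  frame-in transposed iu iv = iv , iu

  frame-out₁ : ∀ o {u v} → R (at o u v) → In₁ o u
  frame-out₁ upright    = proj₁
  frame-out₁ transposed = proj₂

  frame-out₂ : ∀ o {u v} → R (at o u v) → In₂ o v
  frame-out₂ upright    = proj₂
  frame-out₂ transposed = proj₁

  border-v : ∀ o {u v} → OnB (at o u v) → u ≢ lo₁ o → u + 1ℤ ≢ lo₁ o + + n₁ o → EndOf (lo₂ o) (n₂ o) v
  border-v upright    (_ , inj₁ e)                ≢lo _ = ⊥-elim (≢lo e)
  border-v upright    (_ , inj₂ (inj₁ e))         _ ≢end = ⊥-elim (≢end e)
  border-v upright    (_ , inj₂ (inj₂ e))         _ _ = e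
  border-v transposed (_ , inj₁ e)                _ _ = inj₁ e
  border-v transposed (_ , inj₂ (inj₁ e))         _ _ = inj₂ e
  border-v transposed (_ , inj₂ (inj₂ (inj₁ e)))  ≢lo _ = ⊥-elim (≢lo e)
  border-v transposed (_ , inj₂ (inj₂ (inj₂ e)))  _ ≢end = ⊥-elim (≢end e)

  on-border : ∀ {x y} → R (x , y) → EndOf x0 a x ⊎ EndOf y0 b y → OnB (x , y)
  on-border r (inj₁ (inj₁ e)) = r , inj₁ e
  on-border r (inj₁ (inj₂ e)) = r , inj₂ (inj₁ e)
  on-border r (inj₂ (inj₁ e)) = r , inj₂ (inj₂ (inj₁ e))
  on-border r (inj₂ (inj₂ e)) = r , inj₂ (inj₂ (inj₂ e))

  border-from-v : ∀ o {u v} → R (at o u v) → EndOf (lo₂ o) (n₂ o) v → OnB (at o u v)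
  border-from-v upright    r e = on-border r (inj₂ e)
  border-from-v transposed r e = on-border r (inj₁ e)

  no-square : ∀ o {u u′ v v′} → u′ ≡ u + 1ℤ → v′ ≡ v + 1ℤ →
    T (at o u v) → T (at o u′ v) → T (at o u v′) → T (at o u′ v′) → ⊥
  no-square upright    eu ev t₀₀ t₁₀ t₀₁ t₁₁ = no-block eu ev t₀₀ t₁₀ t₀₁ t₁₁
  no-square transposed eu ev t₀₀ t₁₀ t₀₁ t₁₁ = no-block ev eu t₀₀ t₀₁ t₁₀ t₁₁

  -- A domino along the v-axis spanning a rectangle of height two (from the
  -- bottom row to the top row), beside a column u + 1 of the rectangle, is
  -- not made of two tiles: the cell to its side would have to be a hole (else
  -- it closes a block with the rim below), and then its upper neighbour
  -- closes a block with the rim above.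
  thin-domino : ∀ o {u v} → v ≡ lo₂ o → v + 1ℤ + 1ℤ ≡ lo₂ o + + n₂ o →
    In₁ o u → In₁ o (u + 1ℤ) → In₂ o v → In₂ o (v + 1ℤ) →
    T (at o u v) → T (at o u (v + 1ℤ)) → ⊥
  thin-domino o {u} {v} refl top iu iu′ iv iv′ t t′ =
    no-square o refl refl t′ (hole-nbr-tile side-hole (adj-v o refl)) (above iu) (above iu′)
    where
    below : ∀ {w} → In₁ o w → T (at o w (lo₂ o + -1ℤ))
    below iw = rim-tile (frame-in o iw iv) (adj-sym (adj-v o (pred-suc _)))
                        (λ r → below-outside _ _ (frame-out₂ o r))
    above : ∀ {w} → In₁ o w → T (at o w (v + 1ℤ + 1ℤ))
    above iw = rim-tile (frame-in o iw iv′) (adj-v o refl)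
                        (λ r → above-outside (v + 1ℤ) top (frame-out₂ o r))
    side-hole : Hole (at o (u + 1ℤ) v)
    side-hole = nontile-hole (frame-in o iu′ iv)
      (λ t″ → no-square o refl (pred-suc _) (below iu) (below iu′) t t″)

  -- Two border cells adjacent along the v-axis are not both tiles: at an end
  -- of the u-range the rim beside them closes a block; otherwise both lie at
  -- ends of the v-range and the domino is thin.
  domino : ∀ o u {v v′} → v′ ≡ v + 1ℤ → OnB (at o u v) → OnB (at o u v′) →
    T (at o u v) → T (at o u v′) → ⊥
  domino o u refl bd@(r , _) bd′@(r′ , _) t t′ with u ℤP.≟ lo₁ o | u + 1ℤ ℤP.≟ lo₁ o + + n₁ o
  ... | yes refl | _ = no-square o (pred-suc _) refl (rim r) t (rim r′) t′
    where
    rim : ∀ {v} → R (at o (lo₁ o) v) → T (at o (lo₁ o + -1ℤ) v)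
    rim r = rim-tile r (adj-sym (adj-u o (pred-suc _))) (λ r″ → below-outside _ _ (frame-out₁ o r″))
  ... | no _ | yes end = no-square o refl refl t (rim r) t′ (rim r′)
    where
    rim : ∀ {v} → R (at o u v) → T (at o (u + 1ℤ) v)
    rim r = rim-tile r (adj-u o refl) (λ r″ → above-outside u end (frame-out₁ o r″))
  ... | no ≢lo | no ≢end =
    thin-domino o (lower-end (border-v o bd ≢lo ≢end) (frame-out₂ o r′))
                  (upper-end (border-v o bd′ ≢lo ≢end) (frame-out₂ o r))
                  (frame-out₁ o r) (next-within (frame-out₁ o r) ≢end) (frame-out₂ o r) (frame-out₂ o r′) t t′

  border-tiles-apart : ∀ {c c′} → OnB c → OnB c′ → Adj c c′ → T c → T c′ → ⊥
  border-tiles-apart {x , y} bc bc′ (inj₁ (refl , inj₁ e)) t t′ = domino upright x e bc bc′ t t′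
  border-tiles-apart {x , y} bc bc′ (inj₁ (refl , inj₂ e)) t t′ = domino upright x e bc′ bc t′ t
  border-tiles-apart {x , y} bc bc′ (inj₂ (refl , inj₁ e)) t t′ = domino transposed y e bc bc′ t t′
  border-tiles-apart {x , y} bc bc′ (inj₂ (refl , inj₂ e)) t t′ = domino transposed y e bc′ bc t′ t

  alternation : ∀ c c′ → OnB c → OnB c′ → Adj c c′ → (Hole c × T c′) ⊎ (T c × Hole c′)
  alternation c c′ bc bc′ adj with tile-or-hole (proj₁ bc) | tile-or-hole (proj₁ bc′)
  ... | inj₂ H | inj₁ t′ = inj₁ (H , t′)
  ... | inj₁ t | inj₂ H′ = inj₂ (t , H′)
  ... | inj₂ H | inj₂ H′ = ⊥-elim (proj₁ H′ (hole-nbr-tile H adj))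
  ... | inj₁ t | inj₁ t′ = ⊥-elim (border-tiles-apart bc bc′ adj t t′)

  Agrees : ℕ → Cell → Set
  Agrees q c = (T c → colour c ≡ flip q) × (¬ T c → colour c ≡ q)

  class-of : ∀ c → ∃ λ q → q < 2 × Agrees q c
  class-of c with tile? c
  ... | yes t = flip (colour c) , flip<2 (colour c) ,
                (λ _ → sym (flip-involutive (colour<2 c))) , (λ nt → ⊥-elim (nt t))
  ... | no nt = colour c , colour<2 c , (λ t → ⊥-elim (nt t)) , (λ _ → refl)

  -- The colour class p of the holes: the class the corner cell agrees with.
  p : ℕ
  p = proj₁ (class-of (x0 , y0))

  p<2 : p < 2
  p<2 = proj₁ (proj₂ (class-of (x0 , y0)))

  corner-agrees : Agrees p (x0 , y0)
  corner-agrees = proj₂ (proj₂ (class-of (x0 , y0)))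

  -- Agreement passes between adjacent border cells, since they alternate
  -- between holes and tiles while their colours alternate.
  agrees-step : ∀ {c c′} → Agrees p c → OnB c → OnB c′ → Adj c c′ → Agrees p c′
  agrees-step (tile-col , hole-col) bc bc′ adj with alternation _ _ bc bc′ adj
  ... | inj₁ (H , t′) = (λ _ → trans (colour-adj adj) (cong flip (hole-col (proj₁ H)))) ,
                        (λ nt′ → ⊥-elim (nt′ t′))
  ... | inj₂ (t , H′) = (λ t′ → ⊥-elim (proj₁ H′ t′)) ,
                        (λ _ → trans (colour-adj adj) (trans (cong flip (tile-col t)) (flip-involutive p<2)))

  along-side : ∀ o {v} → In₂ o v → EndOf (lo₂ o) (n₂ o) v → Agrees p (at o (lo₁ o) v) →
    ∀ u → In₁ o u → Agrees p (at o u v)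
  along-side o {v} iv end first = interval-ind (lo₁ o) (n₁ o) (λ u → Agrees p (at o u v)) first
    λ u iu iu′ ag → agrees-step ag (border-from-v o (frame-in o iu iv) end)
                                   (border-from-v o (frame-in o iu′ iv) end) (adj-u o refl)

  bottom-side : ∀ x → Within x0 a x → Agrees p (x , y0)
  bottom-side = along-side upright (lo-within y0 b≥1) (inj₁ refl) corner-agrees

  left-side : ∀ y → Within y0 b y → Agrees p (x0 , y)
  left-side = along-side transposed (lo-within x0 a≥1) (inj₁ refl) corner-agrees

  right-side : ∀ y → Within y0 b y → Agrees p (last x0 a , y)
  right-side = along-side transposed (last-within x0 a≥1) (inj₂ (last-end x0 a))
                 (bottom-side _ (last-within x0 a≥1))

  top-side : ∀ x → Within x0 a x → Agrees p (x , last y0 b)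
  top-side = along-side upright (last-within y0 b≥1) (inj₂ (last-end y0 b))
               (left-side _ (last-within y0 b≥1))

  border-agrees : ∀ {c} → OnB c → Agrees p c
  border-agrees {x , y} ((_ , wy) , inj₁ refl)                = left-side y wy
  border-agrees {x , y} ((_ , wy) , inj₂ (inj₁ e))            =
    subst (λ z → Agrees p (z , y)) (sym (end-last x0 a e)) (right-side y wy)
  border-agrees {x , y} ((wx , _) , inj₂ (inj₂ (inj₁ refl)))  = bottom-side x wx
  border-agrees {x , y} ((wx , _) , inj₂ (inj₂ (inj₂ e)))     =
    subst (λ z → Agrees p (x , z)) (sym (end-last y0 b e)) (top-side x wx)

  -- A misplaced cell: an interior non-tile (hence a hole) whose colour is not p.
  -- The second claim says there are none.
  Misplaced : Cell → Set
  Misplaced c = R c × ¬ T c × colour c ≢ p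

  misplaced? : Decidable Misplaced
  misplaced? (x , y) =
    (((x0 ℤP.≤? x) ×-dec (x ℤP.<? x0 + + a)) ×-dec ((y0 ℤP.≤? y) ×-dec (y ℤP.<? y0 + + b))) ×-dec
    ¬? (tile? (x , y)) ×-dec ¬? (colour (x , y) ℕ.≟ p)

  -- Border cells agree with p, so misplaced cells lie strictly inside the rectangle.
  misplaced-inner : ∀ {x y} → Misplaced (x , y) → Inner x0 a x × Inner y0 b y
  misplaced-inner (r@(wx , wy) , nt , ≢p) =
    inner wx (λ e → ≢p (proj₂ (border-agrees (on-border r (inj₁ e))) nt)) ,
    inner wy (λ e → ≢p (proj₂ (border-agrees (on-border r (inj₂ e))) nt))

  near-inside : ∀ {c i j} → Misplaced c → Small i → Small j → R (c ⊕ (i , j))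
  near-inside {x , y} m si sj =
    inner-shift (proj₁ (misplaced-inner m)) si , inner-shift (proj₂ (misplaced-inner m)) sj

  -- The edge-neighbours of a misplaced cell are tiles, as it is a hole of area one.
  beside-misplaced : ∀ {c} → Misplaced c → ∀ κ → T (c ⊕ across κ)
  beside-misplaced (r , nt , _) κ = hole-nbr-tile (nontile-hole r nt) (adj-across _ κ)

  -- A diagonal neighbour inside the rectangle has the same colour, so it is a tile or misplaced.
  diagonal-of-misplaced : ∀ {c} → Misplaced c → ∀ κ → R (c ⊕ (across κ ⊕ across (next κ))) →
    ¬ Misplaced (c ⊕ (across κ ⊕ across (next κ))) → T (c ⊕ (across κ ⊕ across (next κ)))
  diagonal-of-misplaced {c} (_ , _ , ≢p) κ r fine =
    tile-by λ nt → fine (r , nt , λ e → ≢p (trans (sym (colour-diagonal c κ)) e))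

  near-misplaced : ∀ {c i j} → Misplaced c → Small i → Small j →
    ¬ Misplaced (c ⊕ (i , j)) → T (c ⊕ (i , j))
  near-misplaced {c} m s⁰ s⁰ fine = ⊥-elim (fine (subst Misplaced (sym (⊕-identityʳ c)) m))
  near-misplaced m s⁰ s⁻ _ = beside-misplaced m bl
  near-misplaced m s⁺ s⁰ _ = beside-misplaced m br
  near-misplaced m s⁰ s⁺ _ = beside-misplaced m tr
  near-misplaced m s⁻ s⁰ _ = beside-misplaced m tl
  near-misplaced m s⁺ s⁻ fine = diagonal-of-misplaced m bl (near-inside m s⁺ s⁻) fine
  near-misplaced m s⁺ s⁺ fine = diagonal-of-misplaced m br (near-inside m s⁺ s⁺) fine
  near-misplaced m s⁻ s⁺ fine = diagonal-of-misplaced m tr (near-inside m s⁻ s⁺) fine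
  near-misplaced m s⁻ s⁻ fine = diagonal-of-misplaced m tl (near-inside m s⁻ s⁻) fine

  Occupied : Cell → Set
  Occupied w = ∃ λ c → InWindow w c × Misplaced c

  occupied? : Decidable Occupied
  occupied? w = map′ occupant position
    (misplaced? (w ⊕ (0ℤ , 0ℤ)) ⊎-dec misplaced? (w ⊕ (1ℤ , 0ℤ)) ⊎-dec
     misplaced? (w ⊕ (0ℤ , 1ℤ)) ⊎-dec misplaced? (w ⊕ (1ℤ , 1ℤ)))
    where
    Cases : Set
    Cases = Misplaced (w ⊕ (0ℤ , 0ℤ)) ⊎ Misplaced (w ⊕ (1ℤ , 0ℤ)) ⊎
            Misplaced (w ⊕ (0ℤ , 1ℤ)) ⊎ Misplaced (w ⊕ (1ℤ , 1ℤ))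
    occupant : Cases → Occupied w
    occupant (inj₁ m)               = _ , cell-at bit0 bit0 , m
    occupant (inj₂ (inj₁ m))        = _ , cell-at bit1 bit0 , m
    occupant (inj₂ (inj₂ (inj₁ m))) = _ , cell-at bit0 bit1 , m
    occupant (inj₂ (inj₂ (inj₂ m))) = _ , cell-at bit1 bit1 , m
    position : Occupied w → Cases
    position (_ , cell-at bit0 bit0 , m) = inj₁ m
    position (_ , cell-at bit1 bit0 , m) = inj₂ (inj₁ m)
    position (_ , cell-at bit0 bit1 , m) = inj₂ (inj₂ (inj₁ m))
    position (_ , cell-at bit1 bit1 , m) = inj₂ (inj₂ (inj₂ m))

  shared-tile : ∀ {w w′ c} → Occupied w → ¬ Occupied w′ → InWindow w c → InWindow w′ c → T c
  shared-tile (b , b∈w , mb) empty c∈w c∈w′ with window-near b∈w c∈w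
  ... | i , j , si , sj , refl = near-misplaced mb si sj (λ mc → empty (_ , c∈w′ , mc))

  disagree-tile : ∀ {w w′ c} → does (occupied? w) ≢ does (occupied? w′) →
    InWindow w c → InWindow w′ c → T c
  disagree-tile {w} {w′} ne c∈w c∈w′ with decisions-differ (occupied? w) (occupied? w′) ne
  ... | inj₁ (o , e) = shared-tile o e c∈w c∈w′
  ... | inj₂ (e , o) = shared-tile o e c∈w′ c∈w

  occupancy : Cell → Corner → Bool
  occupancy t κ = does (occupied? (t ⊕ window-at κ))

  Switch : Cell → Corner → Set
  Switch t κ = occupancy t κ ≢ occupancy t (next κ)

  -- A cell with a switching side is a tile, and so is its neighbour across it:
  -- both lie in the two windows at the ends of the side.
  switch-tiles : ∀ t κ → Switch t κ → T t × T (t ⊕ across κ)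
  switch-tiles t κ sw with side-shared t κ
  ... | (t∈₁ , t∈₂) , (n∈₁ , n∈₂) =
    subst T (⊕-identityʳ t) (disagree-tile sw t∈₁ t∈₂) , disagree-tile sw n∈₁ n∈₂

  -- Going around the four corners occupancy changes an even number of times,
  -- so a switching side is accompanied by another one.
  other-switch : ∀ t κ → Switch t κ → ∃ λ κ′ → κ′ ≢ κ × Switch t κ′
  other-switch t κ sw
    with another-change Bool._≟_ (occupancy t κ) (occupancy t (next κ)) (occupancy t (next (next κ)))
                                 (occupancy t (next (next (next κ)))) sw
  ... | inj₁ sw₁        = next κ , next≢ κ , sw₁
  ... | inj₂ (inj₁ sw₂) = next (next κ) , next²≢ κ , sw₂
  ... | inj₂ (inj₂ sw₃) = next (next (next κ)) , next³≢ κ ,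
                          subst (λ κ″ → occupancy t (next (next (next κ))) ≢ occupancy t κ″)
                                (sym (next⁴ κ)) sw₃

  -- Crossing a switching side, the opposite side of the neighbour switches:
  -- its ends carry the same two windows.
  cross : ∀ t κ → Switch t κ → Switch (t ⊕ across κ) (opposite κ)
  cross t κ sw same = sw (sym (subst₂ _≡_ (window-moves (proj₁ (across-windows κ)))
                                         (window-moves (proj₂ (across-windows κ))) same))
    where
    window-moves : ∀ {o o′} → across κ ⊕ o ≡ o′ →
                   does (occupied? (t ⊕ across κ ⊕ o)) ≡ does (occupied? (t ⊕ o′))
    window-moves e = cong (λ w → does (occupied? w)) (trans (⊕-assoc t _ _) (cong (t ⊕_) e))

  -- A cell entered through a switching side.
  record Crossing : Set where
    constructor crossing
    field
      cell     : Cell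
      side     : Corner
      switches : Switch cell side
  open Crossing

  -- Leave through another switching side, entering the neighbour through its opposite side.
  exit : (s : Crossing) → ∃ λ κ → κ ≢ side s × Switch (cell s) κ
  exit s = other-switch (cell s) (side s) (switches s)

  advance : Crossing → Crossing
  advance s =
    crossing (cell s ⊕ across κ) (opposite κ) (cross (cell s) κ (proj₂ (proj₂ (exit s))))
    where
    κ : Corner
    κ = proj₁ (exit s)

  -- The walk never turns straight back: the next exit differs from the entry side.
  advance-turns : ∀ s → cell (advance (advance s)) ≢ cell s
  advance-turns s back =
    proj₁ (proj₂ (exit s′)) (across-injective (⊕-cancelˡ (cell s′) (trans back return)))
    where
    s′ : Crossing
    s′ = advance s
    κ : Corner
    κ = proj₁ (exit s)
    return : cell s ≡ cell s′ ⊕ across (opposite κ)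
    return = begin
      cell s                                       ≡⟨ sym (⊕-identityʳ (cell s)) ⟩
      cell s ⊕ 𝟎                                   ≡⟨ cong (cell s ⊕_) (sym (across-opposite κ)) ⟩
      cell s ⊕ (across κ ⊕ across (opposite κ))    ≡⟨ sym (⊕-assoc (cell s) _ _) ⟩
      cell s ⊕ across κ ⊕ across (opposite κ)      ∎
      where open ≡-Reasoning

  trail : Crossing → ℕ → Crossing
  trail s ℕ.zero    = s
  trail s (ℕ.suc k) = advance (trail s k)

  crossing-cycle : Crossing → ∃ (DualCycle ts)
  crossing-cycle s = NonBacktrackingWalk.walk-cycle (λ k → cell (trail s k))
    (λ k → proj₁ (switch-tiles (cell (trail s k)) (side (trail s k)) (switches (trail s k))))
    (λ k → adj-across (cell (trail s k)) (proj₁ (exit (trail s k))))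
    (λ k → advance-turns (trail s k))

  left-clear : ∀ {w} → proj₁ w + 1ℤ ℤ.< x0 → ¬ Occupied w
  left-clear {wx , _} lt (_ , cell-at bi _ , ((x0≤ , _) , _) , _) =
    ℤP.<⇒≱ (ℤP.≤-<-trans (ℤP.+-monoʳ-≤ wx (bit≤1 bi)) lt) x0≤

  slide : Cell → ℕ → Bool
  slide h k = does (occupied? (h ⊕ (- + k , 0ℤ)))

  slide-starts : ∀ h → Misplaced h → slide h 0 ≡ true
  slide-starts h m = dec-true (occupied? (h ⊕ 𝟎))
    (h , subst (InWindow (h ⊕ 𝟎)) (trans (⊕-identityʳ _) (⊕-identityʳ h)) (cell-at bit0 bit0) , m)

  slide-clears : ∀ h → R h → ∃ λ K → slide h K ≡ false
  slide-clears (x , y) (wx , _) with within-index wx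
  ... | n , _ , refl =
    n ℕ.+ 2 , dec-false (occupied? ((x0 + + n , y) ⊕ (- + (n ℕ.+ 2) , 0ℤ)))
                        (left-clear (subst (ℤ._< x0) (sym (far x0 (+ n))) (z-1<z x0)))
    where
    far : ∀ x0 n → x0 + n + - (n + + 2) + 1ℤ ≡ x0 + -1ℤ
    far = solve-∀

  drop-switch : ∀ h k → slide h k ≡ true → slide h (ℕ.suc k) ≡ false →
    Switch (h ⊕ (- + k , 0ℤ)) tr
  drop-switch h k occupied clear same = true≢false (begin
    true                ≡⟨ sym occupied ⟩
    slide h k           ≡⟨ cong (λ c → does (occupied? c)) (sym (⊕-identityʳ w)) ⟩
    occupancy w tr      ≡⟨ same ⟩
    occupancy w tl      ≡⟨ cong (λ c → does (occupied? c)) one-more ⟩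
    slide h (ℕ.suc k)   ≡⟨ clear ⟩
    false               ∎)
    where
    open ≡-Reasoning
    w : Cell
    w = h ⊕ (- + k , 0ℤ)
    minus-one : ∀ z → - z + -1ℤ ≡ - (1ℤ + z)
    minus-one = solve-∀
    one-more : w ⊕ window-at tl ≡ h ⊕ (- + ℕ.suc k , 0ℤ)
    one-more = trans (⊕-assoc h _ _) (cong (λ i → h ⊕ (i , 0ℤ)) (minus-one (+ k)))
    true≢false : true ≢ false
    true≢false ()

  -- From a misplaced cell a crossing is found by sliding leftwards.
  start : ∀ h → Misplaced h → Crossing
  start h m with slide-clears h (proj₁ m)
  ... | K , ends with first-drop (slide h) K (slide-starts h m) ends
  ...   | k , occupied , clear = crossing (h ⊕ (- + k , 0ℤ)) tr (drop-switch h k occupied clear)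

  -- Second claim: every hole has colour p, since a misplaced hole would start
  -- a walk that closes a cycle of the dual graph.
  hole-colour : ∀ h → Hole h → colour h ≡ p
  hole-colour h H = decidable-stable (colour h ℕ.≟ p)
    λ ≢p → no-cycle _ (proj₂ (crossing-cycle (start h (hole-inside H , proj₁ H , ≢p))))

mainTheorem12 : (ts : List Cell) → Polyomino ts → Acyclic ts → HolesAreaOne ts →
  (x0 y0 : ℤ) (a b : ℕ) → 1 ≤ a → 1 ≤ b →
  (∀ c → Interior ts c ⇔ InRect x0 y0 a b c) →
  (∀ c c' → OnBorder x0 y0 a b c → OnBorder x0 y0 a b c' → Adj c c' →
     (HoleCell ts c × Tile ts c') ⊎ (Tile ts c × HoleCell ts c'))
  × (∃[ p ] (p < 2 × (∀ h → HoleCell ts h → InRect x0 y0 a b h × colour h ≡ p)))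
mainTheorem12 ts _ (_ , no-cycle) holes-small x0 y0 a b a≥1 b≥1 interior =
  alternation , p , p<2 , λ h H → hole-inside H , hole-colour h H
  where open Setting ts no-cycle holes-small x0 y0 a b a≥1 b≥1 interior
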